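{- Let $p$ be a prime satisfying $p\equiv 1\pmod 4$, and for nonnegative integers $n$ define $$s_n=64^n\frac{\left(\frac14\right)_n^2}{(n!)^2}=\frac{4^n}{(n!)^2}\prod_{i=0}^{n-1}(1+4i)^2,$$ where $(a)_n=a(a+1)\cdots(a+n-1)$. Then $s_p\equiv s_1\pmod{p^2}$.
   Context: For rational numbers $x,y$ with denominators prime to $p$, $x\equiv y\pmod{p^k}$ means that $x-y$, in lowest terms, has numerator divisible by $p^k$. -}

module Defs where

open import Data.Nat as ℕ using (ℕ; zero; suc; _+_; _*_; _^_)
open import Data.Nat.Combinatorics using ()
open import Data.Nat.Properties using (m*n≢0)
open import Data.Nat.Base using (_!; NonZero)
open import Data.Nat.Properties using (_!≢0)
open import Data.Integer as ℤ using (ℤ; +_)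
open import Data.Rational as ℚ using (ℚ; _/_; _-_; ↥_)
open import Data.Nat.Divisibility using (_∣_)

prod14 : ℕ → ℕ
prod14 zero = 1
prod14 (suc n) = prod14 n * (1 + 4 * n)

-- numerator 4^n ∏_{i<n} (1+4i)^2 (not necessarily in lowest terms)
sNum : ℕ → ℕ
sNum n = 4 ^ n * (prod14 n * prod14 n)

sDen : ℕ → ℕ
sDen n = (n !) * (n !)

sDen-nonZero : ∀ n → NonZero (sDen n)
sDen-nonZero n = m*n≢0 (n !) (n !) {{n !≢0}} {{n !≢0}}

s : ℕ → ℚ
s n = _/_ (+ sNum n) (sDen n) {{sDen-nonZero n}}

-- x ≡ y (mod m) for rationals: m divides the numerator of x - y in lowest terms
_≡_[modℚ_] : ℚ → ℚ → ℕ → Set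
x ≡ y [modℚ m ] = m ∣ ℤ.∣ ↥ (x - y) ∣

module Submission where

-- Let  p = 4k + 1  be prime and  M = (p - 1)! = (4k)!.  Since  s_1 = 4,  and
--   s_p = 4^p ∏_{i<p} (1 + 4i)² / (p!)²,   p! = p M,   ∏_{i<p} (1 + 4i) = p ∏_{j<k} Q_j,
-- the congruence  s_p ≡ s_1 (mod p²)  reduces to  (2^{4k} ∏_j Q_j)² ≡ M² (mod p²),  which
-- follows from the key congruence  2^{4k} M ∏_j Q_j ≡ M² (mod p²).
-- For the latter, regroup both  2^{4k} M = 2·4·…·8k  and  ∏_j Q_j  into  k  blocks: with
-- a, b, c, d = 4j+1, …, 4j+4  the  j-th block of the product is  bd(a+p)(c+p)·a(d+p)(c+2p)(b+3p),
-- which is  m² + p m σ (mod p²)  for  m = abcd  and  σ/m = 1/a + 3/b + 3/c + 1/d.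
-- Multiplying out, the first-order term is  p M² Σ_{x<4k} c_x/(x+1)  with weights  c_x = 1,3,3,1
-- by  x mod 4;  this sum vanishes mod p because  x ↦ 4k - 1 - x  preserves the weights and
-- 1/(x+1) + 1/(4k-x) = p/((x+1)(4k-x)).

open import Defs
open import Data.Nat using (ℕ; zero; suc; _+_; _*_; _∸_; _^_; _≤_; _<_; z≤n; s≤s; _!; NonZero)
open import Data.Nat.Base using (nonTrivial⇒n>1)
open import Data.Nat.Properties
open import Data.Nat.Divisibility
  using (_∣_; divides; _∣0; ∣m∣n⇒∣m+n; ∣n⇒∣m*n; ∣-trans; ∣⇒≤; ∣1⇒≡1; *-cancelˡ-∣; m≤n⇒m!∣n!)
open import Data.Nat.DivMod using (_/_; _%_; m*[n/m]≡n; m≡m%n+[m/n]*n)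
open import Data.Nat.Primality using (Prime; euclidsLemma; prime⇒nonZero; prime⇒nonTrivial)
open import Data.Nat.Tactic.RingSolver using (solve-∀)
open import Data.Integer as ℤ using (ℤ; +_)
import Data.Integer.Properties as ℤP
open import Data.Integer.GCD using () renaming (gcd to gcdℤ)
open import Data.Integer.Tactic.RingSolver renaming (solve-∀ to solve-∀ℤ)
open import Data.Rational as ℚ using (ℚ; ↥_; ↧_)
open import Data.Rational.Properties using (↥-+; ↧-+; ↥-neg; ↧-neg; ↥-/; ↧-/)
open import Data.Product using (∃; _,_; proj₁; proj₂)
open import Data.Sum using (inj₁; inj₂)
open import Data.Empty using (⊥-elim)
open import Relation.Nullary using (¬_)
open import Relation.Binary.PropositionalEquality

prodTo : (ℕ → ℕ) → ℕ → ℕ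
prodTo f zero    = 1
prodTo f (suc n) = prodTo f n * f n

sumTo : (ℕ → ℕ) → ℕ → ℕ
sumTo f zero    = 0
sumTo f (suc n) = sumTo f n + f n

prodTo-cong : ∀ {f g} → (∀ i → f i ≡ g i) → ∀ n → prodTo f n ≡ prodTo g n
prodTo-cong f≗g zero    = refl
prodTo-cong f≗g (suc n) = cong₂ _*_ (prodTo-cong f≗g n) (f≗g n)

prodTo-split : ∀ f m n → prodTo f (m + n) ≡ prodTo f m * prodTo (λ i → f (m + i)) n
prodTo-split f m zero    rewrite +-identityʳ m = sym (*-identityʳ (prodTo f m))
prodTo-split f m (suc n) rewrite +-suc m n | prodTo-split f m n =
  *-assoc (prodTo f m) (prodTo (λ i → f (m + i)) n) (f (m + n))

prodTo-merge : ∀ f g n → prodTo f n * prodTo g n ≡ prodTo (λ i → f i * g i) n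
prodTo-merge f g zero    = refl
prodTo-merge f g (suc n) =
  trans (interchange (prodTo f n) (f n) (prodTo g n) (g n))
        (cong (_* (f n * g n)) (prodTo-merge f g n))
  where
  interchange : ∀ a b c d → a * b * (c * d) ≡ a * c * (b * d)
  interchange = solve-∀

prodTo-blocks : ∀ f m n → prodTo f (n * m) ≡ prodTo (λ j → prodTo (λ i → f (j * m + i)) m) n
prodTo-blocks f m zero    = refl
prodTo-blocks f m (suc n) = begin
  prodTo f (m + n * m)                                      ≡⟨ cong (prodTo f) (+-comm m (n * m)) ⟩
  prodTo f (n * m + m)                                      ≡⟨ prodTo-split f (n * m) m ⟩
  prodTo f (n * m) * prodTo (λ i → f (n * m + i)) m         ≡⟨ cong (_* prodTo (λ i → f (n * m + i)) m) (prodTo-blocks f m n) ⟩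
  prodTo (λ j → prodTo (λ i → f (j * m + i)) m) n * prodTo (λ i → f (n * m + i)) m ∎
  where open ≡-Reasoning

sumTo-cong< : ∀ {f g} n → (∀ i → i < n → f i ≡ g i) → sumTo f n ≡ sumTo g n
sumTo-cong< zero    f≗g = refl
sumTo-cong< (suc n) f≗g =
  cong₂ _+_ (sumTo-cong< n (λ i i<n → f≗g i (m<n⇒m<1+n i<n))) (f≗g n ≤-refl)

sumTo-+ : ∀ f g n → sumTo (λ i → f i + g i) n ≡ sumTo f n + sumTo g n
sumTo-+ f g zero    = refl
sumTo-+ f g (suc n) rewrite sumTo-+ f g n = interchange (sumTo f n) (sumTo g n) (f n) (g n)
  where
  interchange : ∀ a b c d → a + b + (c + d) ≡ a + c + (b + d)
  interchange = solve-∀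

sumTo-∣ : ∀ {d} f n → (∀ i → i < n → d ∣ f i) → d ∣ sumTo f n
sumTo-∣ {d} f zero    d∣f = d ∣0
sumTo-∣     f (suc n) d∣f =
  ∣m∣n⇒∣m+n (sumTo-∣ f n (λ i i<n → d∣f i (m<n⇒m<1+n i<n))) (d∣f n ≤-refl)

sumTo-reverse : ∀ f n → sumTo (λ j → f (n ∸ suc j)) n ≡ sumTo f n
sumTo-reverse f zero    = refl
sumTo-reverse f (suc n) = begin
  sumTo (λ j → f (n ∸ j)) n + f (n ∸ n)         ≡⟨ cong₂ _+_ (sumTo-cong< n shift) (cong f (n∸n≡0 n)) ⟩
  sumTo (λ j → f (suc (n ∸ suc j))) n + f 0     ≡⟨ cong (_+ f 0) (sumTo-reverse (λ j → f (suc j)) n) ⟩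
  sumTo (λ j → f (suc j)) n + f 0               ≡⟨ +-comm _ (f 0) ⟩
  f 0 + sumTo (λ j → f (suc j)) n               ≡⟨ sym (sumTo-first n) ⟩
  sumTo f (suc n)                               ∎
  where
  open ≡-Reasoning
  shift : ∀ j → j < n → f (n ∸ j) ≡ f (suc (n ∸ suc j))
  shift j j<n = cong f (+-∸-assoc 1 j<n)
  sumTo-first : ∀ n → sumTo f (suc n) ≡ f 0 + sumTo (λ j → f (suc j)) n
  sumTo-first zero    = +-comm 0 (f 0)
  sumTo-first (suc n) = trans (cong (_+ f (suc n)) (sumTo-first n)) (+-assoc (f 0) _ _)

sumTo-pairs-∣ : ∀ {d} f g n → (∀ i j → suc (i + j) ≡ n → d ∣ f i + g j) → d ∣ sumTo f n + sumTo g n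
sumTo-pairs-∣ {d} f g n pairs =
  subst (d ∣_) paired (sumTo-∣ (λ i → f i + g (n ∸ suc i)) n
    (λ i i<n → pairs i (n ∸ suc i) (m+[n∸m]≡n i<n)))
  where
  paired : sumTo (λ i → f i + g (n ∸ suc i)) n ≡ sumTo f n + sumTo g n
  paired = trans (sumTo-+ f (λ i → g (n ∸ suc i)) n) (cong (λ u → sumTo f n + u) (sumTo-reverse g n))

-- The first-order coefficient of  ∏_{j<n} (G j + q * H j)  as a polynomial in  q
-- (the derivative of the product at  q = 0).
prodDeriv : (ℕ → ℕ) → (ℕ → ℕ) → ℕ → ℕ
prodDeriv G H zero    = 0
prodDeriv G H (suc n) = prodTo G n * H n + prodDeriv G H n * G n

prodDeriv-quotient : ∀ N G H w n → (∀ j → j < n → N * H j ≡ G j * w j) →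
                     N * prodDeriv G H n ≡ prodTo G n * sumTo w n
prodDeriv-quotient N G H w zero    ratio = *-zeroʳ N
prodDeriv-quotient N G H w (suc n) ratio = begin
  N * (prodTo G n * H n + prodDeriv G H n * G n)         ≡⟨ distribute N (prodTo G n) (H n) (prodDeriv G H n) (G n) ⟩
  prodTo G n * (N * H n) + N * prodDeriv G H n * G n     ≡⟨ cong₂ (λ u v → prodTo G n * u + v * G n)
                                                               (ratio n ≤-refl)
                                                               (prodDeriv-quotient N G H w n (λ j j<n → ratio j (m<n⇒m<1+n j<n))) ⟩
  prodTo G n * (G n * w n) + prodTo G n * sumTo w n * G n ≡⟨ collect (prodTo G n) (G n) (w n) (sumTo w n) ⟩
  prodTo G n * G n * (sumTo w n + w n)                    ∎
  where
  open ≡-Reasoning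
  distribute : ∀ N P h D g → N * (P * h + D * g) ≡ P * (N * h) + N * D * g
  distribute = solve-∀
  collect : ∀ P g w S → P * (g * w) + P * S * g ≡ P * g * (S + w)
  collect = solve-∀

module FirstOrder (q : ℕ) where

  Expansion : ℕ → ℕ → ℕ → Set
  Expansion x c e = ∃ λ z → x ≡ c + q * e + q * q * z

  expand-const : ∀ c → Expansion c c 0
  expand-const c = 0 , trivial c q
    where
    trivial : ∀ c q → c ≡ c + q * 0 + q * q * 0
    trivial = solve-∀

  expand-linear : ∀ c e → Expansion (c + q * e) c e
  expand-linear c e = 0 , trivial c e q
    where
    trivial : ∀ c e q → c + q * e ≡ c + q * e + q * q * 0
    trivial = solve-∀

  expand-* : ∀ {x c e x′ c′ e′} → Expansion x c e → Expansion x′ c′ e′ →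
             Expansion (x * x′) (c * c′) (c * e′ + e * c′)
  expand-* {c = c} {e} {c′ = c′} {e′} (z , refl) (z′ , refl) =
    e * e′ + z * c′ + c * z′ + q * (e * z′ + z * e′) + q * q * (z * z′) , expand c e z c′ e′ z′ q
    where
    expand : ∀ c e z c′ e′ z′ q →
             (c + q * e + q * q * z) * (c′ + q * e′ + q * q * z′)
             ≡ c * c′ + q * (c * e′ + e * c′)
               + q * q * (e * e′ + z * c′ + c * z′ + q * (e * z′ + z * e′) + q * q * (z * z′))
    expand = solve-∀

  expand-≡ : ∀ {x c e x′ c′ e′} → x ≡ x′ → c ≡ c′ → e ≡ e′ → Expansion x c e → Expansion x′ c′ e′
  expand-≡ refl refl refl expansion = expansion

  expand-prodTo : ∀ F G H → (∀ j → Expansion (F j) (G j) (H j)) →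
                  ∀ n → Expansion (prodTo F n) (prodTo G n) (prodDeriv G H n)
  expand-prodTo F G H expansions zero    = expand-const 1
  expand-prodTo F G H expansions (suc n) = expand-* (expand-prodTo F G H expansions n) (expansions n)

  -- One block of the main product:  P Q ≡ m² + q m σ  (mod q²)  where  m = a b c d  and
  -- σ / m = 1/a + 3/b + 3/c + 1/d  is the logarithmic derivative of the shifted factors.
  block-expansion : ∀ a b c d →
    Expansion ((b * d) * ((a + q) * (c + q)) * (a * (d + q) * (c + 2 * q) * (b + 3 * q)))
              ((a * b * c * d) * (a * b * c * d))
              ((a * b * c * d) * (b * c * d + 3 * (a * b * d) + a * b * c + 3 * (a * c * d)))
  block-expansion a b c d = expand-≡ (product a b c d q) (constant a b c d) (derivative a b c d)
    (expand-* (expand-* (expand-const (b * d)) (expand-* (expand-linear a 1) (expand-linear c 1)))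
              (expand-* (expand-* (expand-* (expand-const a) (expand-linear d 1)) (expand-linear c 2)) (expand-linear b 3)))
    where
    product : ∀ a b c d q → b * d * ((a + q * 1) * (c + q * 1)) * (a * (d + q * 1) * (c + q * 2) * (b + q * 3))
                            ≡ (b * d) * ((a + q) * (c + q)) * (a * (d + q) * (c + 2 * q) * (b + 3 * q))
    product = solve-∀
    constant : ∀ a b c d → b * d * (a * c) * (a * d * c * b) ≡ (a * b * c * d) * (a * b * c * d)
    constant = solve-∀
    derivative : ∀ a b c d → b * d * (a * c) * (a * d * c * 3 + (a * d * 2 + (a * 1 + 0 * d) * c) * b)
                               + (b * d * (a * 1 + 1 * c) + 0 * (a * c)) * (a * d * c * b)
                             ≡ (a * b * c * d) * (b * c * d + 3 * (a * b * d) + a * b * c + 3 * (a * c * d))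
    derivative = solve-∀

-- Harmonic numbers modulo a prime  p = n + 1,  scaled by  (p - 1)! = n!  to stay integral.
module Harmonic (n : ℕ) (p-prime : Prime (suc n)) where

  recip : ℕ → ℕ
  recip x = n ! / suc x

  -- For  x + 1 ≤ n  the division is exact, since  (x + 1) ∣ (x + 1)! ∣ n!.
  recip-spec : ∀ x → suc x ≤ n → suc x * recip x ≡ n !
  recip-spec x x<n = m*[n/m]≡n (∣-trans (divides (x !) (*-comm (suc x) (x !))) (m≤n⇒m!∣n! x<n))

  summand-≤ : ∀ x y → suc x + suc y ≡ suc n → suc x ≤ n
  summand-≤ x y sum = subst (suc x ≤_) (trans (sym (+-suc x y)) (suc-injective sum)) (m≤m+n (suc x) y)

  -- Clearing the denominator  x + 1  in  1/(x+1) + 1/(y+1) = p / ((x+1)(y+1)).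
  recip-cleared : ∀ x y → suc x + suc y ≡ suc n → suc x * (recip x + recip y) ≡ recip y * suc n
  recip-cleared x y sum = begin
    suc x * (recip x + recip y)        ≡⟨ *-distribˡ-+ (suc x) (recip x) (recip y) ⟩
    suc x * recip x + suc x * recip y  ≡⟨ cong (_+ suc x * recip y) (trans (recip-spec x (summand-≤ x y sum))
                                                                           (sym (recip-spec y (summand-≤ y x sum′)))) ⟩
    suc y * recip y + suc x * recip y  ≡⟨ sym (*-distribʳ-+ (recip y) (suc y) (suc x)) ⟩
    (suc y + suc x) * recip y          ≡⟨ cong (_* recip y) sum′ ⟩
    suc n * recip y                    ≡⟨ *-comm (suc n) (recip y) ⟩
    recip y * suc n                    ∎
    where
    open ≡-Reasoning
    sum′ : suc y + suc x ≡ suc n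
    sum′ = trans (+-comm (suc y) (suc x)) sum

  recip-pair : ∀ x y → suc x + suc y ≡ suc n → suc n ∣ recip x + recip y
  recip-pair x y sum with euclidsLemma (suc x) (recip x + recip y) p-prime (divides (recip y) (recip-cleared x y sum))
  ... | inj₂ p∣pair = p∣pair
  ... | inj₁ p∣x+1  = ⊥-elim (<⇒≱ (s≤s (summand-≤ x y sum)) (∣⇒≤ p∣x+1))

cross-+ : ∀ x y → ↥ (x ℚ.+ y) ℤ.* (↧ x ℤ.* ↧ y) ≡ (↥ x ℤ.* ↧ y ℤ.+ ↥ y ℤ.* ↧ x) ℤ.* ↧ (x ℚ.+ y)
cross-+ x y =
  trans (cong (↥ (x ℚ.+ y) ℤ.*_) (sym (↧-+ x y)))
        (trans (regroup (↥ (x ℚ.+ y)) (↧ (x ℚ.+ y)) _) (cong (ℤ._* ↧ (x ℚ.+ y)) (↥-+ x y)))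
  where
  regroup : ∀ a b g → a ℤ.* (b ℤ.* g) ≡ a ℤ.* g ℤ.* b
  regroup = solve-∀ℤ

cross-- : ∀ x y → ↥ (x ℚ.- y) ℤ.* (↧ x ℤ.* ↧ y) ≡ (↥ x ℤ.* ↧ y ℤ.- ↥ y ℤ.* ↧ x) ℤ.* ↧ (x ℚ.- y)
cross-- x y = begin
  ↥ (x ℚ.- y) ℤ.* (↧ x ℤ.* ↧ y)                        ≡⟨ cong (λ d → ↥ (x ℚ.- y) ℤ.* (↧ x ℤ.* d)) (sym (↧-neg y)) ⟩
  ↥ (x ℚ.- y) ℤ.* (↧ x ℤ.* ↧ (ℚ.- y))                  ≡⟨ cross-+ x (ℚ.- y) ⟩
  (↥ x ℤ.* ↧ (ℚ.- y) ℤ.+ ↥ (ℚ.- y) ℤ.* ↧ x) ℤ.* ↧ (x ℚ.- y) ≡⟨ cong₂ (λ d u → (↥ x ℤ.* d ℤ.+ u ℤ.* ↧ x) ℤ.* ↧ (x ℚ.- y)) (↧-neg y) (↥-neg y) ⟩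
  (↥ x ℤ.* ↧ y ℤ.+ ℤ.- ↥ y ℤ.* ↧ x) ℤ.* ↧ (x ℚ.- y)     ≡⟨ cong (λ u → (↥ x ℤ.* ↧ y ℤ.+ u) ℤ.* ↧ (x ℚ.- y)) (sym (ℤP.neg-distribˡ-* (↥ y) (↧ x))) ⟩
  (↥ x ℤ.* ↧ y ℤ.- ↥ y ℤ.* ↧ x) ℤ.* ↧ (x ℚ.- y)         ∎
  where open ≡-Reasoning

fraction-difference : ∀ i m j n .{{_ : NonZero m}} .{{_ : NonZero n}} →
  let r = (i ℚ./ m) ℚ.- (j ℚ./ n) in ↥ r ℤ.* (+ m ℤ.* + n) ≡ (i ℤ.* + n ℤ.- j ℤ.* + m) ℤ.* ↧ r
fraction-difference i m j n = begin
  ↥ r ℤ.* (+ m ℤ.* + n)                                 ≡⟨ cong₂ (λ u v → ↥ r ℤ.* (u ℤ.* v)) (sym (↧-/ i m)) (sym (↧-/ j n)) ⟩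
  ↥ r ℤ.* (↧ x ℤ.* g ℤ.* (↧ y ℤ.* h))                   ≡⟨ split (↥ r) (↧ x) (↧ y) g h ⟩
  ↥ r ℤ.* (↧ x ℤ.* ↧ y) ℤ.* (g ℤ.* h)                   ≡⟨ cong (ℤ._* (g ℤ.* h)) (cross-- x y) ⟩
  (↥ x ℤ.* ↧ y ℤ.- ↥ y ℤ.* ↧ x) ℤ.* ↧ r ℤ.* (g ℤ.* h)  ≡⟨ unsplit (↥ x) (↧ x) (↥ y) (↧ y) (↧ r) g h ⟩
  (↥ x ℤ.* g ℤ.* (↧ y ℤ.* h) ℤ.- ↥ y ℤ.* h ℤ.* (↧ x ℤ.* g)) ℤ.* ↧ r
      ≡⟨ cong₂ (λ u v → (u ℤ.- v) ℤ.* ↧ r) (cong₂ ℤ._*_ (↥-/ i m) (↧-/ j n)) (cong₂ ℤ._*_ (↥-/ j n) (↧-/ i m)) ⟩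
  (i ℤ.* + n ℤ.- j ℤ.* + m) ℤ.* ↧ r                      ∎
  where
  open ≡-Reasoning
  x y r : ℚ
  x = i ℚ./ m
  y = j ℚ./ n
  r = x ℚ.- y
  g h : ℤ
  g = gcdℤ i (+ m)
  h = gcdℤ j (+ n)
  split : ∀ a X Y g h → a ℤ.* (X ℤ.* g ℤ.* (Y ℤ.* h)) ≡ a ℤ.* (X ℤ.* Y) ℤ.* (g ℤ.* h)
  split = solve-∀ℤ
  unsplit : ∀ a X b Y d g h → (a ℤ.* Y ℤ.- b ℤ.* X) ℤ.* d ℤ.* (g ℤ.* h)
                              ≡ (a ℤ.* g ℤ.* (Y ℤ.* h) ℤ.- b ℤ.* h ℤ.* (X ℤ.* g)) ℤ.* d
  unsplit = solve-∀ℤ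

numerator-congruence : ∀ N D c K R .{{_ : NonZero D}} → N * K ≡ c * D * K + R →
  let r = ((+ N) ℚ./ D) ℚ.- ((+ c) ℚ./ 1) in ℤ.∣ ↥ r ∣ * (D * K) ≡ R * ℤ.∣ ↧ r ∣
numerator-congruence N D c K R cong-NK =
  trans (sym (ℤP.abs-* (↥ r) (+ (D * K)))) (trans (cong ℤ.∣_∣ integral) (ℤP.abs-* (+ R) (↧ r)))
  where
  open ≡-Reasoning
  r : ℚ
  r = ((+ N) ℚ./ D) ℚ.- ((+ c) ℚ./ 1)
  cD : ℤ
  cD = + c ℤ.* + D
  lifted : + N ℤ.* + K ≡ cD ℤ.* + K ℤ.+ + R
  lifted = begin
    + N ℤ.* + K        ≡⟨ sym (ℤP.pos-* N K) ⟩
    + (N * K)          ≡⟨ cong +_ cong-NK ⟩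
    + (c * D * K + R)  ≡⟨ ℤP.pos-+ (c * D * K) R ⟩
    + (c * D * K) ℤ.+ + R ≡⟨ cong (ℤ._+ + R) (trans (ℤP.pos-* (c * D) K) (cong (ℤ._* + K) (ℤP.pos-* c D))) ⟩
    cD ℤ.* + K ℤ.+ + R ∎
  integral : ↥ r ℤ.* + (D * K) ≡ + R ℤ.* ↧ r
  integral = begin
    ↥ r ℤ.* + (D * K)                             ≡⟨ cong (↥ r ℤ.*_) (ℤP.pos-* D K) ⟩
    ↥ r ℤ.* (+ D ℤ.* + K)                         ≡⟨ insert-one (↥ r) (+ D) (+ K) ⟩
    ↥ r ℤ.* (+ D ℤ.* + 1) ℤ.* + K                 ≡⟨ cong (ℤ._* + K) (fraction-difference (+ N) D (+ c) 1) ⟩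
    (+ N ℤ.* + 1 ℤ.- cD) ℤ.* ↧ r ℤ.* + K           ≡⟨ distribute (+ N) cD (↧ r) (+ K) ⟩
    (+ N ℤ.* + K ℤ.- cD ℤ.* + K) ℤ.* ↧ r           ≡⟨ cong (λ u → (u ℤ.- cD ℤ.* + K) ℤ.* ↧ r) lifted ⟩
    (cD ℤ.* + K ℤ.+ + R ℤ.- cD ℤ.* + K) ℤ.* ↧ r    ≡⟨ cancel (cD ℤ.* + K) (+ R) (↧ r) ⟩
    + R ℤ.* ↧ r                                   ∎
    where
    insert-one : ∀ a D K → a ℤ.* (D ℤ.* K) ≡ a ℤ.* (D ℤ.* + 1) ℤ.* K
    insert-one = solve-∀ℤ
    distribute : ∀ N cD d K → (N ℤ.* + 1 ℤ.- cD) ℤ.* d ℤ.* K ≡ (N ℤ.* K ℤ.- cD ℤ.* K) ℤ.* d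
    distribute = solve-∀ℤ
    cancel : ∀ X R d → (X ℤ.+ R ℤ.- X) ℤ.* d ≡ R ℤ.* d
    cancel = solve-∀ℤ

prime-∤-* : ∀ {P A B} → Prime P → ¬ P ∣ A → ¬ P ∣ B → ¬ P ∣ A * B
prime-∤-* {A = A} {B} P-prime P∤A P∤B P∣AB with euclidsLemma A B P-prime P∣AB
... | inj₁ P∣A = P∤A P∣A
... | inj₂ P∣B = P∤B P∣B

prime-∤-! : ∀ {P} → Prime P → ∀ n → n < P → ¬ P ∣ n !
prime-∤-! {P} P-prime zero    _ P∣1 = <-irrefl (sym (∣1⇒≡1 P∣1)) (nonTrivial⇒n>1 P {{prime⇒nonTrivial P-prime}})
prime-∤-! {P} P-prime (suc n) n<P =
  prime-∤-* P-prime (λ P∣n+1 → <⇒≱ n<P (∣⇒≤ P∣n+1)) (prime-∤-! P-prime n (<-trans (n<1+n n) n<P))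

square-∣-cancel : ∀ {P A B} → Prime P → ¬ P ∣ B → P * P ∣ A * B → P * P ∣ A
square-∣-cancel {P} {A} {B} P-prime P∤B P²∣AB with euclidsLemma A B P-prime (∣-trans (divides P refl) P²∣AB)
... | inj₂ P∣B = ⊥-elim (P∤B P∣B)
... | inj₁ (divides q refl) with euclidsLemma q B P-prime
         (*-cancelˡ-∣ P {{prime⇒nonZero P-prime}}
           (subst (P * P ∣_) (trans (cong (_* B) (*-comm q P)) (*-assoc P q B)) P²∣AB))
... | inj₂ P∣B = ⊥-elim (P∤B P∣B)
... | inj₁ (divides q′ refl) = divides q′ (*-assoc q′ P P)

factorial-prodTo : ∀ n → n ! ≡ prodTo suc n
factorial-prodTo zero    = refl
factorial-prodTo (suc n) = trans (*-comm (suc n) (n !)) (cong (_* suc n) (factorial-prodTo n))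

double-factorial-prodTo : ∀ n → 2 ^ n * n ! ≡ prodTo (λ i → 2 * suc i) n
double-factorial-prodTo zero    = refl
double-factorial-prodTo (suc n) =
  trans (regroup (2 ^ n) (n !) (suc n)) (cong (_* (2 * suc n)) (double-factorial-prodTo n))
  where
  regroup : ∀ X Y s → 2 * X * (s * Y) ≡ X * Y * (2 * s)
  regroup = solve-∀

4^n≡[2^n]² : ∀ n → 4 ^ n ≡ 2 ^ n * 2 ^ n
4^n≡[2^n]² zero    = refl
4^n≡[2^n]² (suc n) = trans (cong (4 *_) (4^n≡[2^n]² n)) (double (2 ^ n))
  where
  double : ∀ x → 4 * (x * x) ≡ 2 * x * (2 * x)
  double = solve-∀

prod14-prodTo : ∀ n → prod14 n ≡ prodTo (λ i → suc (4 * i)) n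
prod14-prodTo zero    = refl
prod14-prodTo (suc n) = cong (_* suc (4 * n)) (prod14-prodTo n)

module Blocks (k : ℕ) where

  p M : ℕ
  p = suc (4 * k)
  M = (4 * k) !

  a b c d m : ℕ → ℕ
  a j = 1 + 4 * j
  b j = 2 + 4 * j
  c j = 3 + 4 * j
  d j = 4 + 4 * j
  m j = a j * b j * c j * d j

  -- The even numbers  2, 4, …, 8k = 2(p - 1)  grouped by  j:  2^{4k} M = ∏_j P j.
  P : ℕ → ℕ
  P j = (b j * d j) * ((a j + p) * (c j + p))

  -- The numbers  1, 5, …, 4p - 3  other than  p  grouped by  j:  prod14 p = p ∏_j Q j.
  Q : ℕ → ℕ
  Q j = a j * (d j + p) * (c j + 2 * p) * (b j + 3 * p)

  factorial-blocks : M ≡ prodTo m k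
  factorial-blocks = begin
    (4 * k) !                                                  ≡⟨ factorial-prodTo (4 * k) ⟩
    prodTo suc (4 * k)                                         ≡⟨ cong (prodTo suc) (*-comm 4 k) ⟩
    prodTo suc (k * 4)                                         ≡⟨ prodTo-blocks suc 4 k ⟩
    prodTo (λ j → prodTo (λ i → suc (j * 4 + i)) 4) k          ≡⟨ prodTo-cong block k ⟩
    prodTo m k                                                 ∎
    where
    open ≡-Reasoning
    block : ∀ j → 1 * suc (j * 4 + 0) * suc (j * 4 + 1) * suc (j * 4 + 2) * suc (j * 4 + 3)
                  ≡ (1 + 4 * j) * (2 + 4 * j) * (3 + 4 * j) * (4 + 4 * j)
    block = solve-∀

  -- 2^{4k} M = 2 · 4 · … · 8k:  block  j  takes  4j+2, 4j+4  from the lower half and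
  -- 4j+2 + (p-1), 4j+4 + (p-1)  from the upper half.
  double-factorial-blocks : 2 ^ (4 * k) * M ≡ prodTo P k
  double-factorial-blocks = begin
    2 ^ (4 * k) * M                                            ≡⟨ double-factorial-prodTo (4 * k) ⟩
    prodTo e (4 * k)                                           ≡⟨ cong (prodTo e) (halves k) ⟩
    prodTo e (k * 2 + k * 2)                                   ≡⟨ prodTo-split e (k * 2) (k * 2) ⟩
    prodTo e (k * 2) * prodTo (λ i → e (k * 2 + i)) (k * 2)    ≡⟨ cong₂ _*_ (prodTo-blocks e 2 k) (prodTo-blocks (λ i → e (k * 2 + i)) 2 k) ⟩
    prodTo (λ j → prodTo (λ i → e (j * 2 + i)) 2) k
      * prodTo (λ j → prodTo (λ i → e (k * 2 + (j * 2 + i))) 2) k ≡⟨ prodTo-merge _ _ k ⟩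
    prodTo (λ j → prodTo (λ i → e (j * 2 + i)) 2 * prodTo (λ i → e (k * 2 + (j * 2 + i))) 2) k
                                                               ≡⟨ prodTo-cong (block k) k ⟩
    prodTo P k                                                 ∎
    where
    open ≡-Reasoning
    e : ℕ → ℕ
    e i = 2 * suc i
    halves : ∀ k → 4 * k ≡ k * 2 + k * 2
    halves = solve-∀
    block : ∀ k j → 1 * (2 * suc (j * 2 + 0)) * (2 * suc (j * 2 + 1))
                    * (1 * (2 * suc (k * 2 + (j * 2 + 0))) * (2 * suc (k * 2 + (j * 2 + 1))))
                  ≡ ((2 + 4 * j) * (4 + 4 * j)) * (((1 + 4 * j) + suc (4 * k)) * ((3 + 4 * j) + suc (4 * k)))
    block = solve-∀

  -- 1 · 5 · … · (4p - 3):  the factors  4i + 1  for  i < k,  then  p,  then three ranges of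
  -- length  k  whose  j-th  entries are  d j + p,  c j + 2p,  b j + 3p.
  prod14-blocks : prod14 p ≡ p * prodTo Q k
  prod14-blocks = begin
    prod14 p                                                              ≡⟨ prod14-prodTo p ⟩
    prodTo f p                                                            ≡⟨ cong (prodTo f) (layout k) ⟩
    prodTo f (k + (1 + (k + (k + k))))                                    ≡⟨ prodTo-split f k (1 + (k + (k + k))) ⟩
    prodTo f k * prodTo f₁ (1 + (k + (k + k)))                            ≡⟨ cong (prodTo f k *_) (prodTo-split f₁ 1 (k + (k + k))) ⟩
    prodTo f k * (prodTo f₁ 1 * prodTo f₂ (k + (k + k)))                  ≡⟨ cong (λ t → prodTo f k * (prodTo f₁ 1 * t)) (prodTo-split f₂ k (k + k)) ⟩
    prodTo f k * (prodTo f₁ 1 * (prodTo f₂ k * prodTo (λ i → f₂ (k + i)) (k + k)))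
                                                                          ≡⟨ cong (λ t → prodTo f k * (prodTo f₁ 1 * (prodTo f₂ k * t))) (prodTo-split (λ i → f₂ (k + i)) k k) ⟩
    prodTo f k * (prodTo f₁ 1 * (prodTo f₂ k * (prodTo f₃ k * prodTo f₄ k)))
                                                                          ≡⟨ regroup (prodTo f k) (prodTo f₁ 1) (prodTo f₂ k) (prodTo f₃ k) (prodTo f₄ k) ⟩
    prodTo f₁ 1 * (prodTo f k * prodTo f₂ k * prodTo f₃ k * prodTo f₄ k)   ≡⟨ cong₂ _*_ (middle k) (merge₄ f f₂ f₃ f₄ k) ⟩
    p * prodTo (λ j → f j * f₂ j * f₃ j * f₄ j) k                         ≡⟨ cong (p *_) (prodTo-cong (block k) k) ⟩
    p * prodTo Q k                                                        ∎
    where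
    open ≡-Reasoning
    f f₁ f₂ f₃ f₄ : ℕ → ℕ
    f i  = suc (4 * i)
    f₁ i = f (k + i)
    f₂ i = f₁ (1 + i)
    f₃ i = f₂ (k + i)
    f₄ i = f₂ (k + (k + i))
    layout : ∀ k → suc (4 * k) ≡ k + (1 + (k + (k + k)))
    layout = solve-∀
    regroup : ∀ A B C D E → A * (B * (C * (D * E))) ≡ B * (A * C * D * E)
    regroup = solve-∀
    middle : ∀ k → 1 * suc (4 * (k + 0)) ≡ suc (4 * k)
    middle = solve-∀
    merge₄ : ∀ f₁ f₂ f₃ f₄ n → prodTo f₁ n * prodTo f₂ n * prodTo f₃ n * prodTo f₄ n
                               ≡ prodTo (λ j → f₁ j * f₂ j * f₃ j * f₄ j) n
    merge₄ f₁ f₂ f₃ f₄ n =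
      trans (cong (λ t → t * prodTo f₃ n * prodTo f₄ n) (prodTo-merge f₁ f₂ n))
            (trans (cong (_* prodTo f₄ n) (prodTo-merge _ f₃ n)) (prodTo-merge _ f₄ n))
    block : ∀ k j → suc (4 * j) * suc (4 * (k + (1 + j))) * suc (4 * (k + (1 + (k + j)))) * suc (4 * (k + (1 + (k + (k + j)))))
                    ≡ (1 + 4 * j) * ((4 + 4 * j) + suc (4 * k)) * ((3 + 4 * j) + 2 * suc (4 * k)) * ((2 + 4 * j) + 3 * suc (4 * k))
    block = solve-∀

module Congruence (k : ℕ) (p-prime : Prime (suc (4 * k))) where
  open Blocks k
  open Harmonic (4 * k) p-prime
  open FirstOrder p

  -- σ j / m j = 1/a + 3/b + 3/c + 1/d  at the  j-th  block.
  σ : ℕ → ℕ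
  σ j = b j * c j * d j + 3 * (a j * b j * d j) + a j * b j * c j + 3 * (a j * c j * d j)

  -- M σ j / m j  as an integer, i.e.  M/a + M/d + 3 (M/b + M/c).
  w : ℕ → ℕ
  w j = recip (4 * j) + recip (3 + 4 * j) + 3 * (recip (1 + 4 * j) + recip (2 + 4 * j))

  residue-< : ∀ {i j} → i < 4 → j < k → i + 4 * j < 4 * k
  residue-< {i} {j} i<4 j<k =
    <-≤-trans (+-monoˡ-< (4 * j) i<4) (subst (_≤ 4 * k) (*-suc 4 j) (*-monoʳ-≤ 4 j<k))

  σ-cleared : ∀ j → j < k → M * σ j ≡ m j * w j
  σ-cleared j j<k = sym (begin
    m j * w j                                         ≡⟨ spread (a j) (b j) (c j) (d j) (recip (4 * j)) (recip (1 + 4 * j)) (recip (2 + 4 * j)) (recip (3 + 4 * j)) ⟩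
    b j * c j * d j * (a j * recip (4 * j)) + a j * b j * c j * (d j * recip (3 + 4 * j))
      + 3 * (a j * c j * d j * (b j * recip (1 + 4 * j)) + a j * b j * d j * (c j * recip (2 + 4 * j)))
        ≡⟨ cong₂ (λ u v → u + 3 * v)
                 (cong₂ (λ u v → b j * c j * d j * u + a j * b j * c j * v) (spec 0 0<4) (spec 3 3<4))
                 (cong₂ (λ u v → a j * c j * d j * u + a j * b j * d j * v) (spec 1 1<4) (spec 2 2<4)) ⟩
    b j * c j * d j * M + a j * b j * c j * M + 3 * (a j * c j * d j * M + a j * b j * d j * M)
                                                      ≡⟨ collect M (a j) (b j) (c j) (d j) ⟩
    M * σ j                                           ∎)
    where
    open ≡-Reasoning
    spec : ∀ i → i < 4 → suc (i + 4 * j) * recip (i + 4 * j) ≡ M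
    spec i i<4 = recip-spec (i + 4 * j) (residue-< i<4 j<k)
    0<4 : 0 < 4
    0<4 = s≤s z≤n
    1<4 : 1 < 4
    1<4 = s≤s (s≤s z≤n)
    2<4 : 2 < 4
    2<4 = s≤s (s≤s (s≤s z≤n))
    3<4 : 3 < 4
    3<4 = ≤-refl
    spread : ∀ a b c d ra rb rc rd → a * b * c * d * (ra + rd + 3 * (rb + rc))
               ≡ b * c * d * (a * ra) + a * b * c * (d * rd) + 3 * (a * c * d * (b * rb) + a * b * d * (c * rc))
    spread = solve-∀
    collect : ∀ M a b c d → b * c * d * M + a * b * c * M + 3 * (a * c * d * M + a * b * d * M)
                ≡ M * (b * c * d + 3 * (a * b * d) + a * b * c + 3 * (a * c * d))
    collect = solve-∀

  -- Σ_j w j = M Σ_{x<4k} c_x/(x+1)  with weights  c_x = 1, 3, 3, 1  by the residue of  x  mod 4;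
  -- the reflection  x ↦ 4k - 1 - x  preserves the weights and pairs  1/(x+1)  with  -1/(x+1) (mod p).
  W-divisible : p ∣ sumTo w k
  W-divisible = subst (p ∣_) (sym (trans (sumTo-cong< k (λ j _ → split j)) (sumTo-+ low high k)))
                      (sumTo-pairs-∣ low high k pair)
    where
    low high : ℕ → ℕ
    low  j = recip (4 * j) + 3 * recip (1 + 4 * j)
    high j = recip (3 + 4 * j) + 3 * recip (2 + 4 * j)
    regroup : ∀ r₀ r₃ r₁ r₂ → r₀ + r₃ + 3 * (r₁ + r₂) ≡ (r₀ + 3 * r₁) + (r₃ + 3 * r₂)
    regroup = solve-∀
    split : ∀ j → w j ≡ low j + high j
    split j = regroup (recip (4 * j)) (recip (3 + 4 * j)) (recip (1 + 4 * j)) (recip (2 + 4 * j))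
    pair : ∀ i j → suc (i + j) ≡ k → p ∣ low i + high j
    pair i j refl = subst (p ∣_) (regroup (recip (4 * i)) (recip (3 + 4 * j)) (recip (1 + 4 * i)) (recip (2 + 4 * j)))
      (∣m∣n⇒∣m+n (recip-pair (4 * i) (3 + 4 * j) (reflect₀ i j)) (∣n⇒∣m*n 3 (recip-pair (1 + 4 * i) (2 + 4 * j) (reflect₁ i j))))
      where
      reflect₀ : ∀ i j → suc (4 * i) + suc (3 + 4 * j) ≡ suc (4 * suc (i + j))
      reflect₀ = solve-∀
      reflect₁ : ∀ i j → suc (1 + 4 * i) + suc (2 + 4 * j) ≡ suc (4 * suc (i + j))
      reflect₁ = solve-∀

  -- Expand  ∏ P Q  blockwise to first order in  p:  the constant term is  M²,  and the
  -- first-order term  prodDeriv  equals  M · Σ w  (logarithmic derivative), divisible by  p.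
  key-congruence : ∃ λ Z → 2 ^ (4 * k) * M * prodTo Q k ≡ M * M + p * p * Z
  key-congruence = M * t + z , (begin
    2 ^ (4 * k) * M * prodTo Q k            ≡⟨ cong (_* prodTo Q k) double-factorial-blocks ⟩
    prodTo P k * prodTo Q k                 ≡⟨ prodTo-merge P Q k ⟩
    prodTo (λ j → P j * Q j) k              ≡⟨ expansion ⟩
    prodTo G k + p * D + p * p * z          ≡⟨ cong₂ (λ u v → u + p * v + p * p * z) main-term first-order-term ⟩
    M * M + p * (M * (t * p)) + p * p * z   ≡⟨ collect M p t z ⟩
    M * M + p * p * (M * t + z)             ∎)
    where
    open ≡-Reasoning
    G H : ℕ → ℕ
    G j = m j * m j
    H j = m j * σ j
    D : ℕ
    D = prodDeriv G H k
    expanded : Expansion (prodTo (λ j → P j * Q j) k) (prodTo G k) D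
    expanded = expand-prodTo _ G H (λ j → block-expansion (a j) (b j) (c j) (d j)) k
    z : ℕ
    z = proj₁ expanded
    expansion : prodTo (λ j → P j * Q j) k ≡ prodTo G k + p * D + p * p * z
    expansion = proj₂ expanded
    main-term : prodTo G k ≡ M * M
    main-term = trans (sym (prodTo-merge m m k)) (cong (λ u → u * u) (sym factorial-blocks))
    ratio : ∀ j → j < k → M * H j ≡ G j * w j
    ratio j j<k = begin
      M * (m j * σ j)    ≡⟨ *-comm-middle M (m j) (σ j) ⟩
      m j * (M * σ j)    ≡⟨ cong (m j *_) (σ-cleared j j<k) ⟩
      m j * (m j * w j)  ≡⟨ sym (*-assoc (m j) (m j) (w j)) ⟩
      m j * m j * w j    ∎
      where
      *-comm-middle : ∀ x y z → x * (y * z) ≡ y * (x * z)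
      *-comm-middle = solve-∀
    open _∣_ W-divisible using () renaming (quotient to t; equality to W≡t*p)
    first-order-term : D ≡ M * (t * p)
    first-order-term = *-cancelˡ-≡ D (M * (t * p)) M {{(4 * k) !≢0}} (begin
      M * D                       ≡⟨ prodDeriv-quotient M G H w k ratio ⟩
      prodTo G k * sumTo w k      ≡⟨ cong₂ _*_ main-term W≡t*p ⟩
      M * M * (t * p)             ≡⟨ *-assoc M M (t * p) ⟩
      M * (M * (t * p))           ∎)
    collect : ∀ M p t z → M * M + p * (M * (t * p)) + p * p * z ≡ M * M + p * p * (M * t + z)
    collect = solve-∀

  -- Clearing denominators in  s_p - s_1:   sNum p · M² ≡ 4 · sDen p · M²  (mod p⁴),
  -- using  sNum p = 4 · (2^{4k})² · p² (∏ Q)²  and  sDen p = (p M)².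
  cleared-numerators : ∃ λ Y → sNum p * (M * M) ≡ 4 * sDen p * (M * M) + p * p * (p * p * Y)
  cleared-numerators = 8 * (M * M) * Z + 4 * (p * p) * (Z * Z) , (begin
    4 * 4 ^ (4 * k) * (prod14 p * prod14 p) * (M * M)     ≡⟨ cong₂ (λ u v → 4 * u * (v * v) * (M * M)) (4^n≡[2^n]² (4 * k)) prod14-blocks ⟩
    4 * (T * T) * ((p * R) * (p * R)) * (M * M)            ≡⟨ gather T M R p ⟩
    4 * (p * p) * ((T * M * R) * (T * M * R))              ≡⟨ cong (λ u → 4 * (p * p) * (u * u)) (proj₂ key-congruence) ⟩
    4 * (p * p) * ((M * M + p * p * Z) * (M * M + p * p * Z)) ≡⟨ expand M p Z ⟩
    4 * ((p * M) * (p * M)) * (M * M) + p * p * (p * p * (8 * (M * M) * Z + 4 * (p * p) * (Z * Z))) ∎)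
    where
    open ≡-Reasoning
    T R Z : ℕ
    T = 2 ^ (4 * k)
    R = prodTo Q k
    Z = proj₁ key-congruence
    gather : ∀ T M R p → 4 * (T * T) * ((p * R) * (p * R)) * (M * M) ≡ 4 * (p * p) * ((T * M * R) * (T * M * R))
    gather = solve-∀
    expand : ∀ M p Z → 4 * (p * p) * ((M * M + p * p * Z) * (M * M + p * p * Z))
                       ≡ 4 * ((p * M) * (p * M)) * (M * M) + p * p * (p * p * (8 * (M * M) * Z + 4 * (p * p) * (Z * Z)))
    expand = solve-∀

-- The theorem for  p = 4k + 1:  the reduced numerator  |↥ r|  of  r = s_p - s_1  satisfies
-- |↥ r| M⁴ = p² Y |↧ r|,  and  p ∤ M.
s-congruence : ∀ k → Prime (suc (4 * k)) → s (suc (4 * k)) ≡ s 1 [modℚ suc (4 * k) ^ 2 ]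
s-congruence k p-prime = subst (_∣ ℤ.∣ ↥ r ∣) (cong (p *_) (sym (*-identityʳ p))) p²∣numerator
  where
  open Blocks k
  open Congruence k p-prime
  r : ℚ
  r = s p ℚ.- s 1
  Y : ℕ
  Y = proj₁ cleared-numerators
  reduced : ℤ.∣ ↥ r ∣ * (sDen p * (M * M)) ≡ p * p * (p * p * Y) * ℤ.∣ ↧ r ∣
  reduced = numerator-congruence (sNum p) (sDen p) 4 (M * M) (p * p * (p * p * Y)) {{sDen-nonZero p}}
                                 (proj₂ cleared-numerators)
  cancelled : ℤ.∣ ↥ r ∣ * (M * M * (M * M)) ≡ Y * ℤ.∣ ↧ r ∣ * (p * p)
  cancelled = trans (*-cancelˡ-≡ _ _ (p * p) (trans (sym (factor-left (ℤ.∣ ↥ r ∣) p M)) (trans reduced (factor-right p Y ℤ.∣ ↧ r ∣))))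
                    (*-comm (p * p) (Y * ℤ.∣ ↧ r ∣))
    where
    factor-left : ∀ A p M → A * ((p * M) * (p * M) * (M * M)) ≡ p * p * (A * (M * M * (M * M)))
    factor-left = solve-∀
    factor-right : ∀ p Y B → p * p * (p * p * Y) * B ≡ p * p * (p * p * (Y * B))
    factor-right = solve-∀
  p∤M : ¬ p ∣ M
  p∤M = prime-∤-! p-prime (4 * k) ≤-refl
  p∤M⁴ : ¬ p ∣ M * M * (M * M)
  p∤M⁴ = prime-∤-* p-prime (prime-∤-* p-prime p∤M p∤M) (prime-∤-* p-prime p∤M p∤M)
  p²∣numerator : p * p ∣ ℤ.∣ ↥ r ∣
  p²∣numerator = square-∣-cancel p-prime p∤M⁴ (divides (Y * ℤ.∣ ↧ r ∣) cancelled)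

lemma3p1 : (p : ℕ) → Prime p → p % 4 ≡ 1 → s p ≡ s 1 [modℚ p ^ 2 ]
lemma3p1 p p-prime p%4≡1 =
  subst (λ q → s q ≡ s 1 [modℚ q ^ 2 ]) (sym p≡4k+1) (s-congruence (p / 4) (subst Prime p≡4k+1 p-prime))
  where
  p≡4k+1 : p ≡ suc (4 * (p / 4))
  p≡4k+1 = trans (m≡m%n+[m/n]*n p 4) (trans (cong (_+ (p / 4) * 4) p%4≡1) (cong suc (*-comm (p / 4) 4)))
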